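{- For every $k\in\mathbb{N}$, the class of (finite) graphs $G$ with $\chi_{\mathrm{lin}}(G)\leq k$ has only finitely many obstructions with respect to the induced subgraph relation, i.e., there are finitely many graphs (up to isomorphism) $H$ with $\chi_{\mathrm{lin}}(H)>k$ such that every proper induced subgraph $H'$ of $H$ satisfies $\chi_{\mathrm{lin}}(H')\leq k$.
   Context: A linear coloring of a graph $G$ is an assignment of integers (colors) to its vertices such that every path of $G$ (as a subgraph) contains a vertex whose color appears exactly once on that path; $\chi_{\mathrm{lin}}(G)$ is the minimum number of colors in a linear coloring of $G$. -}

module Defs where

open import Data.Nat using (ℕ; _<_)
open import Data.Fin using (Fin; _≟_)
open import Data.Bool using (Bool; true; false)
open import Data.List using (List; []; _∷_; filter; length)
open import Data.List.Relation.Unary.Unique.Propositional using (Unique)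
open import Data.List.Relation.Unary.Any using (Any)
open import Data.List.Membership.Propositional using (_∈_)
open import Data.Product using (Σ; ∃; _×_; _,_)
open import Data.Empty using (⊥)
open import Relation.Nullary using (¬_)
open import Relation.Binary.PropositionalEquality using (_≡_)
open import Function.Definitions using (Injective)
open import Function.Bundles using (_↔_)

record Graph : Set where
  field
    n     : ℕ
    adj   : Fin n → Fin n → Bool
    sym   : ∀ i j → adj i j ≡ adj j i
    irrefl : ∀ i → adj i i ≡ false
open Graph public

Walk : (G : Graph) → List (Fin (n G)) → Set
Walk G [] = Data.Unit.⊤ where import Data.Unit
Walk G (u ∷ []) = Data.Unit.⊤ where import Data.Unit
Walk G (u ∷ v ∷ vs) = (adj G u v ≡ true) × Walk G (v ∷ vs)

IsPath : (G : Graph) → List (Fin (n G)) → Set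
IsPath G [] = ⊥
IsPath G (v ∷ vs) = Unique (v ∷ vs) × Walk G (v ∷ vs)

countColour : ∀ {m k} → (Fin m → Fin k) → Fin k → List (Fin m) → ℕ
countColour c a p = length (filter (λ u → c u ≟ a) p)

IsLinearColouring : (G : Graph) {k : ℕ} → (Fin (n G) → Fin k) → Set
IsLinearColouring G c =
  ∀ (p : List (Fin (n G))) → IsPath G p →
    Σ (Fin (n G)) λ v → (v ∈ p) × (countColour c (c v) p ≡ 1)

χlin≤ : Graph → ℕ → Set
χlin≤ G k = Σ (Fin (n G) → Fin k) λ c → IsLinearColouring G c

-- Induced subgraph of G on the image of an injective map f : Fin m → Fin (n G).
induced : (G : Graph) {m : ℕ} → (Fin m → Fin (n G)) → Graph
induced G {m} f = record
  { n = m
  ; adj = λ i j → adj G (f i) (f j)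
  ; sym = λ i j → sym G (f i) (f j)
  ; irrefl = λ i → irrefl G (f i)
  }

_≅_ : Graph → Graph → Set
G ≅ H = Σ (Fin (n G) ↔ Fin (n H)) λ φ →
  ∀ i j → adj G i j ≡ adj H (Function.Bundles.Inverse.to φ i) (Function.Bundles.Inverse.to φ j)

Obstruction : ℕ → Graph → Set
Obstruction k H =
  ¬ χlin≤ H k ×
  (∀ (m : ℕ) (f : Fin m → Fin (n H)) → Injective _≡_ _≡_ f → m < n H →
     χlin≤ (induced H f) k)

{-# OPTIONS --safe #-}
-- A linear colouring with k colours admits no path on 2^k vertices: a vertex whose colour is
-- unique on the path splits it into two paths avoiding that colour. Deleting an end of a path of
-- an obstruction H leaves a path of a proper induced subgraph, so paths of H have at most 2^k
-- vertices.
--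
-- This bounds the size of H, by induction on the depth d. Relative to a set A of ancestors,
-- H − A splits into components, each with a root from which paths have at most d vertices;
-- without its root a component is a region of depth d − 1 with one more ancestor, so components
-- have bounded size and hence boundedly many types (adjacency inside the component and to A).
-- Suppose too many components share a type. Linearly colour H minus one of them, B; by pigeonhole
-- more than 2^k of the others, B′, carry the same colours. Every path of H misses one such B′, and
-- the map sending B onto B′ and fixing all else moves the path into H − B without changing its
-- colours. So copying the colours of B′ onto B linearly colours H, a contradiction.
module Submission where

open import Defs hiding (sym)
open import Data.Bool using (Bool; true; false)
import Data.Bool as Bool
open import Data.Empty using (⊥)
open import Data.Fin as Fin using (Fin; zero; suc; _≟_)
import Data.Fin.Properties as FinP
import Data.Vec.Functional as Vector
open import Data.List using (List; []; _∷_; _++_; [_]; length; filter; map; concatMap; lookup; allFin; upTo)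
import Data.List.Properties as ListP
open import Data.List.Relation.Unary.All as All using (All; []; _∷_)
import Data.List.Relation.Unary.All.Properties as AllP
open import Data.List.Relation.Unary.Any as Any using (Any; here; there)
import Data.List.Relation.Unary.Any.Properties as AnyP
open import Data.List.Relation.Unary.AllPairs using ([]; _∷_; allPairs?)
open import Data.List.Relation.Unary.Unique.Propositional using (Unique)
import Data.List.Relation.Unary.Unique.Propositional.Properties as UniqueP
open import Data.List.Relation.Binary.Subset.Propositional using (_⊆_)
open import Data.List.Membership.Propositional using (_∈_; _∉_; find; lose)
open import Data.List.Membership.Propositional.Properties
  using (∈-∃++; ∈-++⁺ˡ; ∈-++⁺ʳ; ∈-filter⁺; ∈-filter⁻; ∈-map⁻; ∈-lookup; ∈-allFin; ∈-upTo⁺)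
open import Data.Nat using (ℕ; zero; suc; _+_; _*_; _^_; _≤_; _<_; z≤n; s≤s; _<?_)
open import Data.Nat.Properties
  using (≤-reflexive; ≤-trans; ≤-pred; <-≤-trans; ≤-<-trans; ≮⇒≥; ≤⇒≯; <⇒≱; +-mono-≤; +-monoˡ-≤; *-monoˡ-≤;
         +-identityʳ; +-suc; m+n≡0⇒m≡0; m+n≡0⇒n≡0; n≤1+n; m^n>0; suc-injective; module ≤-Reasoning)
open import Data.Product as Product using (Σ; ∃; _×_; _,_; proj₁; proj₂)
open import Data.Sum as Sum using (_⊎_; inj₁; inj₂)
open import Data.Unit using (tt)
open import Function using (_∘_)
open import Function.Definitions using (Injective)
open import Function.Construct.Identity using (↔-id)
open import Relation.Binary using (DecidableEquality; tri<; tri≈; tri>)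
open import Relation.Binary.PropositionalEquality
  using (_≡_; _≢_; refl; sym; trans; cong; subst; subst₂; module ≡-Reasoning)
open import Relation.Nullary using (¬_; Dec; yes; no; ¬?; contradiction)
open import Relation.Nullary.Decidable using (_×-dec_; _→-dec_)
open import Relation.Unary using (Decidable)

module _ {A : Set} where

  ∈-++-∷⁻ : ∀ {w v : A} xs ys → w ∈ xs ++ v ∷ ys → w ≡ v ⊎ w ∈ xs ++ ys
  ∈-++-∷⁻ []       ys (here w≡v) = inj₁ w≡v
  ∈-++-∷⁻ []       ys (there w∈) = inj₂ w∈
  ∈-++-∷⁻ (x ∷ xs) ys (here w≡x) = inj₂ (here w≡x)
  ∈-++-∷⁻ (x ∷ xs) ys (there w∈) = Sum.map₂ there (∈-++-∷⁻ xs ys w∈)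

  length-++-∷ : ∀ {v : A} xs ys → length (xs ++ v ∷ ys) ≡ suc (length (xs ++ ys))
  length-++-∷ []       ys = refl
  length-++-∷ (x ∷ xs) ys = cong suc (length-++-∷ xs ys)

  unique-++⁻ : ∀ xs {ys : List A} → Unique (xs ++ ys) → Unique xs × Unique ys
  unique-++⁻ []       u          = [] , u
  unique-++⁻ (x ∷ xs) (x∉ ∷ u) = Product.map₁ (AllP.++⁻ˡ xs x∉ ∷_) (unique-++⁻ xs u)

  unique⊆⇒length≤ : ∀ {xs ys : List A} → Unique xs → xs ⊆ ys → length xs ≤ length ys
  unique⊆⇒length≤ {[]}     _          _     = z≤n
  unique⊆⇒length≤ {x ∷ xs} (x∉ ∷ u) xs⊆ys with ∈-∃++ (xs⊆ys (here refl))
  ... | ys₁ , ys₂ , refl =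
    subst (suc (length xs) ≤_) (sym (length-++-∷ ys₁ ys₂)) (s≤s (unique⊆⇒length≤ u xs⊆ys₁ys₂))
    where
    xs⊆ys₁ys₂ : xs ⊆ ys₁ ++ ys₂
    xs⊆ys₁ys₂ v∈ with ∈-++-∷⁻ ys₁ ys₂ (xs⊆ys (there v∈))
    ... | inj₁ refl = contradiction refl (All.lookup x∉ v∈)
    ... | inj₂ v∈′  = v∈′

  lookup-injective : ∀ {xs : List A} → Unique xs → ∀ {i j} → lookup xs i ≡ lookup xs j → i ≡ j
  lookup-injective {x ∷ xs} _          {zero}  {zero}  _ = refl
  lookup-injective {x ∷ xs} (x∉ ∷ _) {zero}  {suc j} e = contradiction e (All.lookup x∉ (∈-lookup j))
  lookup-injective {x ∷ xs} (x∉ ∷ _) {suc i} {zero}  e = contradiction (sym e) (All.lookup x∉ (∈-lookup i))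
  lookup-injective {x ∷ xs} (_ ∷ u)  {suc i} {suc j} e = cong suc (lookup-injective u e)

  map-unique-on : ∀ {B : Set} (f : A → B) {xs} → Unique xs →
                  (∀ {u v} → u ∈ xs → v ∈ xs → f u ≡ f v → u ≡ v) → Unique (map f xs)
  map-unique-on f {[]}     []         _     = []
  map-unique-on f {x ∷ xs} (x∉ ∷ u) f-inj =
    All.tabulate fx∉ ∷ map-unique-on f u (λ u∈ v∈ → f-inj (there u∈) (there v∈))
    where
    fx∉ : ∀ {w} → w ∈ map f xs → f x ≢ w
    fx∉ w∈ fx≡w with ∈-map⁻ f w∈
    ... | y , y∈ , refl = All.lookup x∉ y∈ (f-inj (here refl) (there y∈) fx≡w)

length-allFin : ∀ N → length (allFin N) ≡ N
length-allFin N = ListP.length-tabulate {n = N} (λ i → i)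

module _ {A B : Set} (f : A → List B) {s : ℕ} where

  length-concatMap≤ : ∀ xs → (∀ {x} → x ∈ xs → length (f x) ≤ s) → length (concatMap f xs) ≤ length xs * s
  length-concatMap≤ []       _     = z≤n
  length-concatMap≤ (x ∷ xs) small =
    subst (_≤ s + length xs * s) (sym (ListP.length-++ (f x)))
      (+-mono-≤ (small (here refl)) (length-concatMap≤ xs (small ∘ there)))

module _ {A C : Set} (_≟ᶜ_ : DecidableEquality C) (code : A → C) where

  fibre : C → List A → List A
  fibre τ = filter (λ x → code x ≟ᶜ τ)

  fibre⁻ : ∀ {τ x xs} → x ∈ fibre τ xs → x ∈ xs × code x ≡ τ
  fibre⁻ {τ} {xs = xs} = ∈-filter⁻ (λ x → code x ≟ᶜ τ) {xs = xs}

  fibre-unique : ∀ {τ xs} → Unique xs → Unique (fibre τ xs)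
  fibre-unique {τ} = UniqueP.filter⁺ (λ x → code x ≟ᶜ τ)

  pigeonhole : ∀ {U xs} M → Unique xs → All (λ x → code x ∈ U) xs → length U * M < length xs →
               ∃ λ τ → M < length (fibre τ xs)
  pigeonhole {U} {xs} M uxs codes big with Any.any? (λ τ → M <? length (fibre τ xs)) U
  ... | yes crowded = Any.satisfied crowded
  ... | no ¬crowded = contradiction big (≤⇒≯ (begin
    length xs                              ≤⟨ unique⊆⇒length≤ uxs xs⊆fibres ⟩
    length (concatMap (λ τ → fibre τ xs) U) ≤⟨ length-concatMap≤ (λ τ → fibre τ xs) U small ⟩
    length U * M                           ∎))
    where
    open ≤-Reasoning
    small : ∀ {τ} → τ ∈ U → length (fibre τ xs) ≤ M
    small τ∈ = ≮⇒≥ (¬crowded ∘ lose τ∈)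
    xs⊆fibres : xs ⊆ concatMap (λ τ → fibre τ xs) U
    xs⊆fibres x∈ = AnyP.concatMap⁺ (λ τ → fibre τ xs)
      (Any.map (∈-filter⁺ (λ x → code x ≟ᶜ _) x∈) (All.lookup codes x∈))

module _ {X V : Set} (B : X → V → Set) (B? : ∀ x v → Dec (B x v)) where

  avoided-block : ∀ {Y} → Unique Y → (∀ {y₁ y₂ v} → y₁ ∈ Y → y₂ ∈ Y → y₁ ≢ y₂ → B y₁ v → ¬ B y₂ v) →
                  ∀ P → length P < length Y → ∃ λ y → y ∈ Y × (∀ {v} → v ∈ P → ¬ B y v)
  avoided-block {y ∷ Y} (y∉ ∷ uY) disjoint P P<Y with Any.any? (B? y) P
  ... | no ¬meets = y , here refl , λ v∈ b → ¬meets (lose v∈ b)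
  ... | yes meets with find meets
  ... | v , v∈ , bv with ∈-∃++ v∈
  ... | P₁ , P₂ , refl with avoided-block uY (λ m₁ m₂ → disjoint (there m₁) (there m₂)) (P₁ ++ P₂)
                             (≤-pred (subst (_< suc (length Y)) (length-++-∷ P₁ P₂) P<Y))
  ... | y′ , y′∈ , avoids = y′ , there y′∈ , avoids′
    where
    avoids′ : ∀ {w} → w ∈ P₁ ++ v ∷ P₂ → ¬ B y′ w
    avoids′ w∈ with ∈-++-∷⁻ P₁ P₂ w∈
    ... | inj₁ refl = disjoint (here refl) (there y′∈) (All.lookup y∉ y′∈) bv
    ... | inj₂ w∈′  = avoids w∈′

least : ∀ {N} (Q : Fin N → Set) → Decidable Q → ∀ x → Q x → ∃ λ x₀ → Q x₀ × (∀ x₁ → x₁ Fin.< x₀ → ¬ Q x₁)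
least {suc N} Q Q? x qx with Q? zero
... | yes q₀ = zero , q₀ , λ _ ()
least {suc N} Q Q? zero    qx | no ¬q₀ = contradiction qx ¬q₀
least {suc N} Q Q? (suc x) qx | no ¬q₀ with least (Q ∘ suc) (Q? ∘ suc) x qx
... | x₀ , q , below = suc x₀ , q , below′
  where
  below′ : ∀ x₁ → x₁ Fin.< suc x₀ → ¬ Q x₁
  below′ zero     _         = ¬q₀
  below′ (suc x₁) (s≤s lt) = below x₁ lt

module _ {A : Set} where

  lastOf : A → List A → A
  lastOf y []      = y
  lastOf y (z ∷ q) = lastOf z q

  lastOf-++-∷ : ∀ (y z : A) xs q → lastOf y (xs ++ z ∷ q) ≡ lastOf z q
  lastOf-++-∷ y z []       q = refl
  lastOf-++-∷ y z (x ∷ xs) q = lastOf-++-∷ x z xs q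

  listsUpTo : ℕ → List A → List (List A)
  listsUpTo zero    univ = [ [] ]
  listsUpTo (suc l) univ = [] ∷ concatMap (λ x → map (x ∷_) (listsUpTo l univ)) univ

  listsUpTo-complete : ∀ l univ (xs : List A) → length xs ≤ l → All (_∈ univ) xs → xs ∈ listsUpTo l univ
  listsUpTo-complete zero    univ []       _         _            = here refl
  listsUpTo-complete (suc l) univ []       _         _            = here refl
  listsUpTo-complete (suc l) univ (x ∷ xs) (s≤s len) (x∈ ∷ xs∈) =
    there (AnyP.concatMap⁺ (λ x → map (x ∷_) (listsUpTo l univ))
      (Any.map (λ { refl → AnyP.map⁺ (Any.map (cong (x ∷_)) (listsUpTo-complete l univ xs len xs∈)) }) x∈))

module Relabel {X : Set} (_≟ˣ_ : DecidableEquality X) where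

  relabel : List X → List X → X → X
  relabel []       _        v = v
  relabel (x ∷ xs) []       v = v
  relabel (x ∷ xs) (y ∷ ys) v with v ≟ˣ x
  ... | yes _ = y
  ... | no  _ = relabel xs ys v

  private
    ∈-∷-≢ : ∀ {x v : X} {xs} → v ∈ x ∷ xs → v ≢ x → v ∈ xs
    ∈-∷-≢ (here v≡x) v≢x = contradiction v≡x v≢x
    ∈-∷-≢ (there v∈) _   = v∈

  relabel-∉ : ∀ xs ys {v} → v ∉ xs → relabel xs ys v ≡ v
  relabel-∉ []       ys       _  = refl
  relabel-∉ (x ∷ xs) []       _  = refl
  relabel-∉ (x ∷ xs) (y ∷ ys) {v} v∉ with v ≟ˣ x
  ... | yes v≡x = contradiction (here v≡x) v∉
  ... | no  _   = relabel-∉ xs ys (v∉ ∘ there)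

  relabel-∈ : ∀ xs ys {v} → length xs ≡ length ys → v ∈ xs → relabel xs ys v ∈ ys
  relabel-∈ (x ∷ xs) (y ∷ ys) {v} e v∈ with v ≟ˣ x
  ... | yes _   = here refl
  ... | no  v≢x = there (relabel-∈ xs ys (suc-injective e) (∈-∷-≢ v∈ v≢x))

  relabel-injective-on : ∀ xs ys → length xs ≡ length ys → Unique ys →
                         ∀ {u v} → u ∈ xs → v ∈ xs → relabel xs ys u ≡ relabel xs ys v → u ≡ v
  relabel-injective-on (x ∷ xs) (y ∷ ys) e (y∉ ∷ uys) {u} {v} u∈ v∈ eq with u ≟ˣ x | v ≟ˣ x
  ... | yes u≡x | yes v≡x = trans u≡x (sym v≡x)
  ... | yes _   | no  v≢x =
    contradiction eq (All.lookup y∉ (relabel-∈ xs ys (suc-injective e) (∈-∷-≢ v∈ v≢x)))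
  ... | no  u≢x | yes _   =
    contradiction (sym eq) (All.lookup y∉ (relabel-∈ xs ys (suc-injective e) (∈-∷-≢ u∈ u≢x)))
  ... | no  u≢x | no  v≢x =
    relabel-injective-on xs ys (suc-injective e) uys (∈-∷-≢ u∈ u≢x) (∈-∷-≢ v∈ v≢x) eq

  relabel-map : ∀ {Y : Set} (F G : X → Y) xs ys → map F xs ≡ map G ys →
                ∀ {v} → v ∈ xs → F v ≡ G (relabel xs ys v)
  relabel-map F G (x ∷ xs) (y ∷ ys) e {v} v∈ with v ≟ˣ x
  ... | yes refl = ListP.∷-injectiveˡ e
  ... | no  v≢x  = relabel-map F G xs ys (ListP.∷-injectiveʳ e) (∈-∷-≢ v∈ v≢x)

  relabel-map-cong : ∀ {Y : Set} (F : X → Y) xs ys zs → length xs ≡ length ys → length xs ≡ length zs →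
                     map F ys ≡ map F zs → ∀ {v} → v ∈ xs → F (relabel xs ys v) ≡ F (relabel xs zs v)
  relabel-map-cong F (x ∷ xs) (y ∷ ys) (z ∷ zs) e₁ e₂ e {v} v∈ with v ≟ˣ x
  ... | yes _   = ListP.∷-injectiveˡ e
  ... | no  v≢x = relabel-map-cong F xs ys zs (suc-injective e₁) (suc-injective e₂) (ListP.∷-injectiveʳ e)
                    (∈-∷-≢ v∈ v≢x)

  relabel-self : ∀ zs v → relabel zs zs v ≡ v
  relabel-self []       v = refl
  relabel-self (z ∷ zs) v with v ≟ˣ z
  ... | yes v≡z = sym v≡z
  ... | no  _   = relabel-self zs v

  relabel-++ : ∀ xs ys zs v → length xs ≡ length ys → relabel (xs ++ zs) (ys ++ zs) v ≡ relabel xs ys v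
  relabel-++ []       []       zs v _ = relabel-self zs v
  relabel-++ (x ∷ xs) (y ∷ ys) zs v e with v ≟ˣ x
  ... | yes _ = refl
  ... | no  _ = relabel-++ xs ys zs v (suc-injective e)

SimpleWalk : (G : Graph) → List (Fin (n G)) → Set
SimpleWalk G p = Unique p × Walk G p

module _ (G : Graph) where

  walk-tail : ∀ {x ys} → Walk G (x ∷ ys) → Walk G ys
  walk-tail {ys = []}    _       = tt
  walk-tail {ys = _ ∷ _} (_ , w) = w

  walk-++⁻ : ∀ xs {ys} → Walk G (xs ++ ys) → Walk G xs × Walk G ys
  walk-++⁻ []           w       = tt , w
  walk-++⁻ (x ∷ [])     w       = tt , walk-tail w
  walk-++⁻ (x ∷ y ∷ xs) (e , w) = Product.map₁ (e ,_) (walk-++⁻ (y ∷ xs) w)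

  simpleWalk-++⁻ : ∀ xs {ys} → SimpleWalk G (xs ++ ys) → SimpleWalk G xs × SimpleWalk G ys
  simpleWalk-++⁻ xs (u , w) with unique-++⁻ xs u | walk-++⁻ xs w
  ... | u₁ , u₂ | w₁ , w₂ = (u₁ , w₁) , (u₂ , w₂)

  walk? : Decidable (Walk G)
  walk? []           = yes tt
  walk? (x ∷ [])     = yes tt
  walk? (x ∷ y ∷ xs) with adj G x y Bool.≟ true | walk? (y ∷ xs)
  ... | yes e  | yes w  = yes (e , w)
  ... | no ¬e  | _      = no (¬e ∘ proj₁)
  ... | _      | no ¬w  = no (¬w ∘ proj₂)

  simpleWalk? : Decidable (SimpleWalk G)
  simpleWalk? p = allPairs? (λ u v → ¬? (u ≟ v)) p ×-dec walk? p

walk-map-on : ∀ (G G′ : Graph) (φ : Fin (n G) → Fin (n G′)) {p} → Walk G p →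
              (∀ {u v} → u ∈ p → v ∈ p → adj G u v ≡ true → adj G′ (φ u) (φ v) ≡ true) → Walk G′ (map φ p)
walk-map-on G G′ φ {[]}         _       _     = tt
walk-map-on G G′ φ {x ∷ []}     _       _     = tt
walk-map-on G G′ φ {x ∷ y ∷ p} (e , w) edges =
  edges (here refl) (there (here refl)) e , walk-map-on G G′ φ w (λ u∈ v∈ → edges (there u∈) (there v∈))

-- Linear colourings

module _ {m k} (c : Fin m → Fin k) where

  countColour≡0 : ∀ {a} p → countColour c a p ≡ 0 → All (λ u → c u ≢ a) p
  countColour≡0     []      _    = []
  countColour≡0 {a} (u ∷ p) none with c u ≟ a
  ... | yes _    = contradiction none λ ()
  ... | no cu≢a = cu≢a ∷ countColour≡0 p none

  uniqueColour-split : ∀ p₁ {v} p₂ → countColour c (c v) (p₁ ++ v ∷ p₂) ≡ 1 →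
                       All (λ u → c u ≢ c v) p₁ × All (λ u → c u ≢ c v) p₂
  uniqueColour-split p₁ {v} p₂ once =
    countColour≡0 p₁ (m+n≡0⇒m≡0 (count p₁) none) , countColour≡0 p₂ (m+n≡0⇒n≡0 (count p₁) none)
    where
    open ≡-Reasoning
    P? : Decidable (λ u → c u ≡ c v)
    P? u = c u ≟ c v
    count : List (Fin m) → ℕ
    count = countColour c (c v)
    none : count p₁ + count p₂ ≡ 0
    none = suc-injective (begin
      suc (count p₁ + count p₂)
        ≡⟨ sym (+-suc (count p₁) (count p₂)) ⟩
      count p₁ + suc (count p₂)
        ≡⟨ cong (λ q → count p₁ + length q) (sym (ListP.filter-accept P? refl)) ⟩
      count p₁ + count (v ∷ p₂)
        ≡⟨ sym (ListP.length-++ (filter P? p₁)) ⟩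
      length (filter P? p₁ ++ filter P? (v ∷ p₂))
        ≡⟨ cong length (sym (ListP.filter-++ P? p₁ (v ∷ p₂))) ⟩
      count (p₁ ++ v ∷ p₂)
        ≡⟨ once ⟩
      1 ∎)

  countColour-map : ∀ {m′} (c′ : Fin m′ → Fin k) (φ : Fin m → Fin m′) a p →
                    (∀ {v} → v ∈ p → c′ (φ v) ≡ c v) → countColour c′ a (map φ p) ≡ countColour c a p
  countColour-map c′ φ a []      _        = refl
  countColour-map c′ φ a (x ∷ p) same with c′ (φ x) ≟ a | c x ≟ a
  ... | yes _    | yes _    = cong suc (countColour-map c′ φ a p (same ∘ there))
  ... | no  _    | no  _    = countColour-map c′ φ a p (same ∘ there)
  ... | yes c′x≡a | no  cx≢a = contradiction (trans (sym (same (here refl))) c′x≡a) cx≢a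
  ... | no  c′x≢a | yes cx≡a = contradiction (trans (same (here refl)) cx≡a) c′x≢a

module _ {G G′ : Graph} {k} {c′ : Fin (n G′) → Fin k} (lin : IsLinearColouring G′ c′) (c : Fin (n G) → Fin k) where

  uniquelyColoured-pullback : ∀ (φ : Fin (n G) → Fin (n G′)) p → IsPath G p →
    (∀ {u v} → u ∈ p → v ∈ p → φ u ≡ φ v → u ≡ v) →
    (∀ {u v} → u ∈ p → v ∈ p → adj G u v ≡ true → adj G′ (φ u) (φ v) ≡ true) →
    (∀ {v} → v ∈ p → c′ (φ v) ≡ c v) →
    ∃ λ v → v ∈ p × countColour c (c v) p ≡ 1
  uniquelyColoured-pullback φ p@(_ ∷ _) (u , w) injective edges same
    with lin (map φ p) (map-unique-on φ u injective , walk-map-on G G′ φ w edges)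
  ... | _ , φv∈ , once with ∈-map⁻ φ φv∈
  ... | v , v∈ , refl = v , v∈ , (begin
    countColour c (c v) p                ≡⟨ sym (countColour-map c c′ φ (c v) p same) ⟩
    countColour c′ (c v) (map φ p)       ≡⟨ cong (λ a → countColour c′ a (map φ p)) (sym (same v∈)) ⟩
    countColour c′ (c′ (φ v)) (map φ p) ≡⟨ once ⟩
    1                                    ∎)
    where open ≡-Reasoning

module _ (G : Graph) {k} (c : Fin (n G) → Fin k) (lin : IsLinearColouring G c) where

  simpleWalk-length< : ∀ j {S : List (Fin k)} → length S ≤ j → Unique S →
                       ∀ {p} → SimpleWalk G p → All (λ u → c u ∈ S) p → length p < 2 ^ j
  split-length< : ∀ j {S : List (Fin k)} → length S ≤ suc j → Unique S →
                  ∀ {p} → SimpleWalk G p → All (λ u → c u ∈ S) p →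
                  ∀ {v} p₁ p₂ → p ≡ p₁ ++ v ∷ p₂ → countColour c (c v) p ≡ 1 → length p < 2 ^ suc j

  simpleWalk-length< j       _  _  {[]}    _  _          = m^n>0 2 j
  simpleWalk-length< zero    {[]} _ _ {_ ∷ _} _ (() ∷ _)
  simpleWalk-length< zero    {_ ∷ _} () _ _ _
  simpleWalk-length< (suc j) |S|≤ uS {p@(_ ∷ _)} sw colours with lin p sw
  ... | v , v∈ , once with ∈-∃++ v∈
  ... | p₁ , p₂ , p≡ = split-length< j |S|≤ uS sw colours p₁ p₂ p≡ once

  split-length< j {S} |S|≤ uS sw colours {v} p₁ p₂ refl once = begin-strict
    length (p₁ ++ v ∷ p₂)        ≡⟨ ListP.length-++ p₁ ⟩
    length p₁ + length (v ∷ p₂)  <⟨ +-mono-≤ (bound p₁ (proj₁ halves) (AllP.++⁻ˡ p₁ colours) (proj₁ others))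
                                            (bound p₂ (proj₂ halves) colours₂ (proj₂ others)) ⟩
    2 ^ j + 2 ^ j                ≡⟨ cong (2 ^ j +_) (sym (+-identityʳ (2 ^ j))) ⟩
    2 ^ suc j                    ∎
    where
    open ≤-Reasoning
    a : Fin k
    a = c v
    ≢a? : Decidable (_≢ a)
    ≢a? b = ¬? (b ≟ a)
    |S∖a|≤ : length (filter ≢a? S) ≤ j
    |S∖a|≤ = ≤-pred (<-≤-trans (ListP.filter-notAll ≢a? S
               (Any.map (λ a≡b b≢a → b≢a (sym a≡b)) (All.lookup colours (∈-++⁺ʳ p₁ (here refl))))) |S|≤)
    bound : ∀ q → SimpleWalk G q → All (λ u → c u ∈ S) q → All (λ u → c u ≢ a) q → length q < 2 ^ j
    bound q sw′ inS ≢as = simpleWalk-length< j |S∖a|≤ (UniqueP.filter⁺ ≢a? uS) sw′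
      (All.zipWith (λ (u∈ , u≢a) → ∈-filter⁺ ≢a? u∈ u≢a) (inS , ≢as))
    others : All (λ u → c u ≢ a) p₁ × All (λ u → c u ≢ a) p₂
    others = uniqueColour-split c p₁ p₂ once
    halves : SimpleWalk G p₁ × SimpleWalk G p₂
    halves = Product.map₂ (λ { (_ ∷ u , w) → u , walk-tail G w }) (simpleWalk-++⁻ G p₁ sw)
    colours₂ : All (λ u → c u ∈ S) p₂
    colours₂ = All.tail (AllP.++⁻ʳ p₁ colours)

  path-length<2^k : ∀ {p} → IsPath G p → length p < 2 ^ k
  path-length<2^k {_ ∷ _} path = simpleWalk-length< k (≤-reflexive (length-allFin k)) (UniqueP.allFin⁺ k) path
    (All.tabulate (λ _ → ∈-allFin _))

-- Deleting vertices

module Deletion (H : Graph) {C : Fin (n H) → Set} (C? : Decidable C) where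

  kept : List (Fin (n H))
  kept = filter (¬? ∘ C?) (allFin (n H))

  m : ℕ
  m = length kept

  embed : Fin m → Fin (n H)
  embed = lookup kept

  embed-injective : Injective _≡_ _≡_ embed
  embed-injective = lookup-injective (UniqueP.filter⁺ (¬? ∘ C?) (UniqueP.allFin⁺ (n H)))

  H∖C : Graph
  H∖C = induced H embed

  kept⁺ : ∀ {v} → ¬ C v → v ∈ kept
  kept⁺ ¬cv = ∈-filter⁺ (¬? ∘ C?) (∈-allFin _) ¬cv

  deletion-smaller : ∀ {v} → C v → m < n H
  deletion-smaller {v} cv = subst (m <_) (length-allFin (n H))
    (ListP.filter-notAll (¬? ∘ C?) (allFin (n H)) (Any.map (λ { refl ¬cv → ¬cv cv }) (∈-allFin v)))

  module Restriction (default : Fin m) where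

    restrict : Fin (n H) → Fin m
    restrict v with Any.any? (v ≟_) kept
    ... | yes v∈ = Any.index v∈
    ... | no  _  = default

    embed∘restrict : ∀ {v} → ¬ C v → embed (restrict v) ≡ v
    embed∘restrict {v} ¬cv with Any.any? (v ≟_) kept
    ... | yes v∈ = sym (AnyP.lookup-index v∈)
    ... | no  v∉ = contradiction (kept⁺ ¬cv) v∉

    restrict-injective : ∀ {u v} → ¬ C u → ¬ C v → restrict u ≡ restrict v → u ≡ v
    restrict-injective ¬cu ¬cv e = trans (sym (embed∘restrict ¬cu)) (trans (cong embed e) (embed∘restrict ¬cv))

    restrict-adj : ∀ {u v} → ¬ C u → ¬ C v → adj H u v ≡ true → adj H∖C (restrict u) (restrict v) ≡ true
    restrict-adj ¬cu ¬cv = subst₂ (λ u v → adj H u v ≡ true) (sym (embed∘restrict ¬cu)) (sym (embed∘restrict ¬cv))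

    restrict-simpleWalk : ∀ {p} → SimpleWalk H p → All (¬_ ∘ C) p → SimpleWalk H∖C (map restrict p)
    restrict-simpleWalk (u , w) ¬cs =
      map-unique-on restrict u (λ u∈ v∈ → restrict-injective (All.lookup ¬cs u∈) (All.lookup ¬cs v∈)) ,
      walk-map-on H H∖C restrict w (λ u∈ v∈ → restrict-adj (All.lookup ¬cs u∈) (All.lookup ¬cs v∈))

module _ {H : Graph} {k} (obs : Obstruction k H) where

  colour-deletion : ∀ {C} (C? : Decidable C) {v} → C v → χlin≤ (Deletion.H∖C H C?) k
  colour-deletion C? cv = proj₂ obs _ embed embed-injective (deletion-smaller cv)
    where open Deletion H C?

  obstruction-path≤2^k : ∀ {p} → IsPath H p → length p ≤ 2 ^ k
  obstruction-path≤2^k {x ∷ []}    _                  = m^n>0 2 k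
  obstruction-path≤2^k {x ∷ y ∷ q} (x∉ ∷ u , _ , w) =
    subst (λ l → suc l ≤ 2 ^ k) (ListP.length-map restrict (y ∷ q))
      (path-length<2^k H∖C (proj₁ χ) (proj₂ χ)
        (restrict-simpleWalk (u , w) (All.map (λ x≢v → x≢v ∘ sym) x∉)))
    where
    open Deletion H (_≟ x)
    open Restriction (Any.index (kept⁺ {y} (All.head x∉ ∘ sym)))
    χ : χlin≤ H∖C k
    χ = colour-deletion (_≟ x) refl

-- Connectivity inside a vertex set

module Connectivity (H : Graph) where

  V : Set
  V = Fin (n H)

  Reach : (V → Set) → V → V → Set
  Reach W x y = ∃ λ q → IsPath H (y ∷ q) × All W (y ∷ q) × lastOf y q ≡ x

  module _ {W : V → Set} where

    reach-refl : ∀ {x} → W x → Reach W x x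
    reach-refl wx = [] , ([] ∷ [] , tt) , wx ∷ [] , refl

    reach-source : ∀ {x y} → Reach W x y → W y
    reach-source (_ , _ , wy ∷ _ , _) = wy

    -- z is prepended unless it already lies on the path, in which case the suffix from z is taken.
    reach-step : ∀ {x y z} → Reach W x y → W z → adj H z y ≡ true → Reach W x z
    reach-step {x} {y} {z} (q , (u , w) , ws , last≡x) wz zy with Any.any? (z ≟_) (y ∷ q)
    ... | no z∉ = y ∷ q , (All.tabulate (λ v∈ z≡v → z∉ (subst (_∈ y ∷ q) (sym z≡v) v∈)) ∷ u , zy , w) ,
                  wz ∷ ws , last≡x
    ... | yes z∈ with ∈-∃++ z∈
    ... | pre , suffix , y∷q≡ =
      suffix , proj₂ (simpleWalk-++⁻ H pre (subst (SimpleWalk H) y∷q≡ (u , w))) ,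
      AllP.++⁻ʳ pre (subst (All W) y∷q≡ ws) , trans (sym (lastOf-suffix pre y∷q≡)) last≡x
      where
      lastOf-suffix : ∀ pre → y ∷ q ≡ pre ++ z ∷ suffix → lastOf y q ≡ lastOf z suffix
      lastOf-suffix []        refl = refl
      lastOf-suffix (_ ∷ pre) refl = lastOf-++-∷ y z pre suffix

    reach-along : ∀ {a} y q → Walk H (y ∷ q) → All W (y ∷ q) → Reach W a y → Reach W a (lastOf y q)
    reach-along y []       _       _          r = r
    reach-along y (y′ ∷ q) (e , w) (_ ∷ ws) r =
      reach-along y′ q w ws (reach-step r (All.head ws) (trans (Graph.sym H y′ y) e))

    reach-sym : ∀ {x y} → Reach W x y → Reach W y x
    reach-sym {y = y} (q , (_ , w) , ws , refl) = reach-along y q w ws (reach-refl (All.head ws))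

    reach-trans : ∀ {a x y} → Reach W a x → Reach W x y → Reach W a y
    reach-trans r s with reach-sym s
    ... | q , (_ , w) , ws , refl = reach-along _ q w ws r

  reach? : ∀ {W} → Decidable W → ∀ (L : ℕ) → (∀ {p} → IsPath H p → length p ≤ L) → ∀ x y → Dec (Reach W x y)
  reach? {W} W? L short x y with Any.any? witness? (listsUpTo L (allFin (n H)))
    where
    witness? : ∀ q → Dec (IsPath H (y ∷ q) × All W (y ∷ q) × lastOf y q ≡ x)
    witness? q = simpleWalk? H (y ∷ q) ×-dec All.all? W? (y ∷ q) ×-dec lastOf y q ≟ x
  ... | yes found = yes (Any.satisfied found)
  ... | no ¬found = no λ (q , path , rest) → ¬found (lose (listsUpTo-complete L (allFin (n H)) q
                      (≤-trans (n≤1+n (length q)) (short path)) (All.tabulate (λ _ → ∈-allFin _))) (path , rest))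

-- Bounding the size of an obstruction

booleans : List Bool
booleans = true ∷ false ∷ []

∈-booleans : ∀ b → b ∈ booleans
∈-booleans true  = here refl
∈-booleans false = there (here refl)

blockTypes : ℕ → ℕ → List (List (List Bool))
blockTypes s a = listsUpTo s (listsUpTo (s + a) booleans)

blockColourings : ∀ k → ℕ → List (List (Fin k))
blockColourings k s = listsUpTo s (allFin k)

twinBound : ℕ → ℕ → ℕ
twinBound k s = suc (length (blockColourings k s) * 2 ^ k)

-- s bounds a component: its root plus a region of depth d below it, which has one more ancestor.
regionBound : ℕ → ℕ → ℕ → ℕ
regionBound k zero    a = 0
regionBound k (suc d) a = length (blockTypes s a) * twinBound k s * s
  where s = suc (regionBound k d (suc a))

module ObstructionSize {H : Graph} {k : ℕ} (obs : Obstruction k H) where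

  open Connectivity H
  open Relabel (_≟_ {n H})

  L : ℕ
  L = 2 ^ k

  reachable? : ∀ {W} → Decidable W → ∀ x y → Dec (Reach W x y)
  reachable? W? = reach? W? L (obstruction-path≤2^k obs)

  module BlockPruning
    (A : List V) (Block : V → V → Set) (Block? : ∀ x v → Dec (Block x v))
    (reps : List V) (reps-unique : Unique reps)
    (self : ∀ {x} → x ∈ reps → Block x x)
    (closed : ∀ {x u v} → x ∈ reps → Block x u → adj H u v ≡ true → Block x v ⊎ v ∈ A)
    (disjoint : ∀ {x₁ x₂ v} → x₁ ∈ reps → x₂ ∈ reps → x₁ ≢ x₂ → Block x₁ v → ¬ Block x₂ v)
    (s : ℕ) (small : ∀ {x} → x ∈ reps → length (filter (Block? x) (allFin (n H))) ≤ s)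
    where

    block : V → List V
    block x = filter (Block? x) (allFin (n H))

    block⁺ : ∀ {x v} → Block x v → v ∈ block x
    block⁺ b = ∈-filter⁺ (Block? _) (∈-allFin _) b

    block⁻ : ∀ {x v} → v ∈ block x → Block x v
    block⁻ {x} v∈ = proj₂ (∈-filter⁻ (Block? x) {xs = allFin (n H)} v∈)

    type : V → List (List Bool)
    type x = map (λ u → map (adj H u) (block x ++ A)) (block x)

    type∈ : ∀ {x} → x ∈ reps → type x ∈ blockTypes s (length A)
    type∈ {x} x∈ = listsUpTo-complete s _ (type x)
      (≤-trans (≤-reflexive (ListP.length-map _ (block x))) (small x∈))
      (AllP.map⁺ (All.tabulate λ {u} _ → listsUpTo-complete (s + length A) booleans (map (adj H u) (block x ++ A))
        (≤-trans (≤-reflexive (trans (ListP.length-map _ (block x ++ A)) (ListP.length-++ (block x))))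
                 (+-monoˡ-≤ (length A) (small x∈)))
        (All.tabulate λ {b} _ → ∈-booleans b)))

    module Twins (x₀ : V) (x₀∈ : x₀ ∈ reps) where

      open Deletion H (Block? x₀)

      IsTwin : V → Set
      IsTwin y = y ∈ reps × y ≢ x₀ × type y ≡ type x₀

      transplant : V → V → V
      transplant y = relabel (block x₀) (block y)

      transplant-∉ : ∀ y {v} → v ∉ block x₀ → transplant y v ≡ v
      transplant-∉ y = relabel-∉ (block x₀) (block y)

      neighbour∈ : ∀ {u v} → u ∈ block x₀ → adj H u v ≡ true → v ∈ block x₀ ++ A
      neighbour∈ u∈ e = Sum.[ ∈-++⁺ˡ ∘ block⁺ , ∈-++⁺ʳ (block x₀) ]′ (closed x₀∈ (block⁻ u∈) e)

      module Twin {y} (twin : IsTwin y) where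

        private
          y∈ : y ∈ reps
          y∈ = proj₁ twin
          y≢x₀ : y ≢ x₀
          y≢x₀ = proj₁ (proj₂ twin)
          same-type : type y ≡ type x₀
          same-type = proj₂ (proj₂ twin)

        lengths : length (block x₀) ≡ length (block y)
        lengths = trans (sym (ListP.length-map _ (block x₀)))
                    (trans (cong length (sym same-type)) (ListP.length-map _ (block y)))

        transplant-∈ : ∀ {v} → v ∈ block x₀ → Block y (transplant y v)
        transplant-∈ v∈ = block⁻ (relabel-∈ (block x₀) (block y) lengths v∈)

        transplant-misses : ∀ v → ¬ Block x₀ (transplant y v)
        transplant-misses v with Any.any? (v ≟_) (block x₀)
        ... | yes v∈ = disjoint y∈ x₀∈ y≢x₀ (transplant-∈ v∈)
        ... | no  v∉ = subst (¬_ ∘ Block x₀) (sym (transplant-∉ y v∉)) (v∉ ∘ block⁺)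

        transplant-adj-block : ∀ {u w} → u ∈ block x₀ → w ∈ block x₀ ++ A →
                               adj H u w ≡ adj H (transplant y u) (transplant y w)
        transplant-adj-block {u} {w} u∈ w∈ = begin
          adj H u w
            ≡⟨ relabel-map (adj H u) (adj H (transplant y u)) (block x₀ ++ A) (block y ++ A) row w∈ ⟩
          adj H (transplant y u) (relabel (block x₀ ++ A) (block y ++ A) w)
            ≡⟨ cong (adj H (transplant y u)) (relabel-++ (block x₀) (block y) A w lengths) ⟩
          adj H (transplant y u) (transplant y w)
            ∎
          where
          open ≡-Reasoning
          row : map (adj H u) (block x₀ ++ A) ≡ map (adj H (transplant y u)) (block y ++ A)
          row = relabel-map (λ u → map (adj H u) (block x₀ ++ A)) (λ u → map (adj H u) (block y ++ A))
                  (block x₀) (block y) (sym same-type) u∈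

        transplant-adj : ∀ u v → adj H u v ≡ true → adj H (transplant y u) (transplant y v) ≡ true
        transplant-adj u v e with Any.any? (u ≟_) (block x₀) | Any.any? (v ≟_) (block x₀)
        ... | yes u∈ | _      = trans (sym (transplant-adj-block u∈ (neighbour∈ u∈ e))) e
        ... | no  _  | yes v∈ =
          trans (Graph.sym H _ _) (trans (sym (transplant-adj-block v∈ (neighbour∈ v∈ e′))) e′)
          where
          e′ : adj H v u ≡ true
          e′ = trans (Graph.sym H v u) e
        ... | no  u∉ | no  v∉ =
          subst₂ (λ u′ v′ → adj H u′ v′ ≡ true) (sym (transplant-∉ y u∉)) (sym (transplant-∉ y v∉)) e

        transplant-injective-on : ∀ P → (∀ {v} → v ∈ P → ¬ Block y v) →
                                  ∀ {u v} → u ∈ P → v ∈ P → transplant y u ≡ transplant y v → u ≡ v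
        transplant-injective-on P avoids {u} {v} u∈P v∈P e
          with Any.any? (u ≟_) (block x₀) | Any.any? (v ≟_) (block x₀)
        ... | yes u∈ | yes v∈ =
          relabel-injective-on (block x₀) (block y) lengths (UniqueP.filter⁺ _ (UniqueP.allFin⁺ (n H))) u∈ v∈ e
        ... | yes u∈ | no  v∉ =
          contradiction (subst (Block y) (trans e (transplant-∉ y v∉)) (transplant-∈ u∈)) (avoids v∈P)
        ... | no  u∉ | yes v∈ =
          contradiction (subst (Block y) (trans (sym e) (transplant-∉ y u∉)) (transplant-∈ v∈)) (avoids u∈P)
        ... | no  u∉ | no  v∉ = trans (sym (transplant-∉ y u∉)) (trans e (transplant-∉ y v∉))

      module Colouring (default : Fin m) (c : Fin m → Fin k) (lin : IsLinearColouring H∖C c) where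

        open Restriction default

        colouring : V → List (Fin k)
        colouring x = map (c ∘ restrict) (block x)

        -- A path of H has at most L vertices, so it misses the block of one of these twins, y say;
        -- transplant y then moves it into H ∖ block x₀ without changing its colours under c′.
        same-coloured-twins≤ : ∀ {κ} Y → Unique Y → All (λ y → IsTwin y × colouring y ≡ κ) Y → length Y ≤ L
        same-coloured-twins≤ []       _  _      = z≤n
        same-coloured-twins≤ (y₀ ∷ Y) uY twins = ≮⇒≥ λ L<Y → proj₁ obs (c′ , linear L<Y)
          where
          c′ : V → Fin k
          c′ = c ∘ restrict ∘ transplant y₀
          rep : ∀ {y} → y ∈ y₀ ∷ Y → y ∈ reps
          rep y∈ = proj₁ (proj₁ (All.lookup twins y∈))
          linear : L < length (y₀ ∷ Y) → IsLinearColouring H c′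
          linear L<Y P path
            with avoided-block Block Block? uY (λ y₁∈ y₂∈ → disjoint (rep y₁∈) (rep y₂∈))
                   P (≤-<-trans (obstruction-path≤2^k obs path) L<Y)
          ... | y , y∈Y , avoids =
            uniquelyColoured-pullback lin c′ (restrict ∘ transplant y) P path injective edges same-colour
            where
            open Twin (proj₁ (All.lookup twins y∈Y))
            injective : ∀ {u v} → u ∈ P → v ∈ P → restrict (transplant y u) ≡ restrict (transplant y v) → u ≡ v
            injective {u} {v} u∈ v∈ e =
              transplant-injective-on P avoids u∈ v∈ (restrict-injective (transplant-misses u) (transplant-misses v) e)
            edges : ∀ {u v} → u ∈ P → v ∈ P → adj H u v ≡ true →
                    adj H∖C (restrict (transplant y u)) (restrict (transplant y v)) ≡ true
            edges {u} {v} _ _ e = restrict-adj (transplant-misses u) (transplant-misses v) (transplant-adj u v e)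
            same-colour : ∀ {v} → v ∈ P → c (restrict (transplant y v)) ≡ c′ v
            same-colour {v} _ with Any.any? (v ≟_) (block x₀)
            ... | yes v∈ = relabel-map-cong (c ∘ restrict) (block x₀) (block y) (block y₀) lengths
                             (Twin.lengths (proj₁ (All.head twins)))
                             (trans (proj₂ (All.lookup twins y∈Y)) (sym (proj₂ (All.head twins)))) v∈
            ... | no  v∉ = cong (c ∘ restrict) (trans (transplant-∉ y v∉) (sym (transplant-∉ y₀ v∉)))

      twins≤ : ∀ X → Unique X → All IsTwin X → length X ≤ length (blockColourings k s) * L
      twins≤ []       _  _      = z≤n
      twins≤ (x₁ ∷ X) uX twins@((x₁∈ , x₁≢x₀ , _) ∷ _) = ≮⇒≥ λ many →
        let κ , crowded = pigeonhole _≟ᶜ_ colouring L uX (All.map colouring∈ twins) many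
        in  <⇒≱ crowded (same-coloured-twins≤ (fibre _≟ᶜ_ colouring κ (x₁ ∷ X)) (fibre-unique _≟ᶜ_ colouring uX)
              (All.tabulate λ y∈ → let y∈X , cy = fibre⁻ _≟ᶜ_ colouring y∈ in All.lookup twins y∈X , cy))
        where
        _≟ᶜ_ : DecidableEquality (List (Fin k))
        _≟ᶜ_ = ListP.≡-dec _≟_
        χ : χlin≤ H∖C k
        χ = colour-deletion obs (Block? x₀) (self x₀∈)
        x₁∉ : ¬ Block x₀ x₁
        x₁∉ = disjoint x₁∈ x₀∈ x₁≢x₀ (self x₁∈)
        open Colouring (Any.index (kept⁺ x₁∉)) (proj₁ χ) (proj₂ χ)
        colouring∈ : ∀ {x} → IsTwin x → colouring x ∈ blockColourings k s
        colouring∈ {x} (x∈ , _) = listsUpTo-complete s (allFin k) (colouring x)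
          (≤-trans (≤-reflexive (ListP.length-map _ (block x))) (small x∈)) (All.tabulate λ _ → ∈-allFin _)

    type-class≤ : ∀ {τ} X → Unique X → All (λ x → x ∈ reps × type x ≡ τ) X → length X ≤ twinBound k s
    type-class≤ []       _           _                       = z≤n
    type-class≤ (x₀ ∷ X) (x₀∉ ∷ uX) ((x₀∈ , refl) ∷ class) =
      s≤s (Twins.twins≤ x₀ x₀∈ X uX
        (All.zipWith (λ (x₀≢x , x∈ , same) → x∈ , x₀≢x ∘ sym , same) (x₀∉ , class)))

    few-blocks : length reps ≤ length (blockTypes s (length A)) * twinBound k s
    few-blocks = ≮⇒≥ λ many →
      let τ , crowded = pigeonhole _≟ᵗ_ type (twinBound k s) reps-unique (All.tabulate type∈) many
      in  <⇒≱ crowded (type-class≤ (fibre _≟ᵗ_ type τ reps) (fibre-unique _≟ᵗ_ type reps-unique)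
            (All.tabulate (fibre⁻ _≟ᵗ_ type)))
      where
      _≟ᵗ_ : DecidableEquality (List (List Bool))
      _≟ᵗ_ = ListP.≡-dec (ListP.≡-dec Bool._≟_)

  record Region (d : ℕ) (A : List V) (W R : V → Set) : Set where
    field
      closed  : ∀ {u v} → W u → adj H u v ≡ true → W v ⊎ v ∈ A
      roots⊆  : ∀ {v} → R v → W v
      shallow : ∀ y q → IsPath H (y ∷ q) → All W (y ∷ q) → R y → length (y ∷ q) ≤ d
      rooted  : ∀ {y} → W y → ∃ λ x → R x × Reach W x y

  module Rooted {d A W R} (W? : Decidable W) (R? : Decidable R) (reg : Region (suc d) A W R) where

    open Region reg

    Below : V → V → Set
    Below x v = Reach W x v × v ≢ x

    Below? : ∀ x → Decidable (Below x)
    Below? x v = reachable? W? x v ×-dec ¬? (v ≟ x)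

    Child : V → V → Set
    Child x v = Below x v × adj H x v ≡ true

    Child? : ∀ x → Decidable (Child x)
    Child? x v = Below? x v ×-dec adj H x v Bool.≟ true

    subregion : ∀ {x} → R x → Region d (x ∷ A) (Below x) (Child x)
    subregion {x} rx = record
      { closed  = closed′
      ; roots⊆  = proj₁
      ; shallow = shallow′
      ; rooted  = λ ((q , path , ws , last≡x) , y≢x) → reach-child _ q path ws last≡x y≢x
      }
      where
      closed′ : ∀ {u v} → Below x u → adj H u v ≡ true → Below x v ⊎ v ∈ x ∷ A
      closed′ {u} {v} (ru , _) e with closed (reach-source ru) e | v ≟ x
      ... | inj₂ v∈A | _       = inj₂ (there v∈A)
      ... | inj₁ _   | yes v≡x = inj₂ (here v≡x)
      ... | inj₁ wv  | no  v≢x = inj₁ (reach-step ru wv (trans (Graph.sym H v u) e) , v≢x)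
      shallow′ : ∀ y q → IsPath H (y ∷ q) → All (Below x) (y ∷ q) → Child x y → length (y ∷ q) ≤ d
      shallow′ y q (u , w) below (_ , xy) = ≤-pred (shallow x (y ∷ q)
        (All.map (λ (_ , v≢x) x≡v → v≢x (sym x≡v)) below ∷ u , xy , w)
        (roots⊆ rx ∷ All.map (reach-source ∘ proj₁) below) rx)
      reach-child : ∀ y q → IsPath H (y ∷ q) → All W (y ∷ q) → lastOf y q ≡ x → y ≢ x →
                    ∃ λ x′ → Child x x′ × Reach (Below x) x′ y
      reach-child y []       _                   _          last≡x y≢x = contradiction last≡x y≢x
      reach-child y (y′ ∷ q) path@(_ ∷ u , e , w) ws@(_ ∷ ws′) last≡x y≢x with y′ ≟ x
      ... | yes refl = y , (below-y , trans (Graph.sym H y′ y) e) , reach-refl below-y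
        where
        below-y : Below y′ y
        below-y = (y′ ∷ q , path , ws , last≡x) , y≢x
      ... | no y′≢x with reach-child y′ q (u , w) ws′ last≡x y′≢x
      ... | x′ , child , r = x′ , child , reach-step r ((y′ ∷ q , path , ws , last≡x) , y≢x) e

    component : V → List V
    component x = filter (reachable? W? x) (allFin (n H))

    component-size≤ : ∀ x {b} → length (filter (Below? x) (allFin (n H))) ≤ b → length (component x) ≤ suc b
    component-size≤ x below≤ =
      ≤-trans (unique⊆⇒length≤ (UniqueP.filter⁺ _ (UniqueP.allFin⁺ (n H))) ⊆x∷below) (s≤s below≤)
      where
      ⊆x∷below : component x ⊆ x ∷ filter (Below? x) (allFin (n H))
      ⊆x∷below {v} v∈ with v ≟ x
      ... | yes v≡x = here v≡x
      ... | no  v≢x = there (∈-filter⁺ (Below? x) (∈-allFin v)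
                        (proj₂ (∈-filter⁻ (reachable? W? x) {xs = allFin (n H)} v∈) , v≢x))

    IsRep : V → Set
    IsRep x = R x × (∀ x₁ → x₁ Fin.< x → R x₁ → ¬ Reach W x₁ x)

    IsRep? : Decidable IsRep
    IsRep? x = R? x ×-dec FinP.all? λ x₁ → x₁ Fin.<? x →-dec (R? x₁ →-dec ¬? (reachable? W? x₁ x))

    reps : List V
    reps = filter IsRep? (allFin (n H))

    rep⁻ : ∀ {x} → x ∈ reps → IsRep x
    rep⁻ x∈ = proj₂ (∈-filter⁻ IsRep? {xs = allFin (n H)} x∈)

    components-disjoint : ∀ {x₁ x₂ v} → x₁ ∈ reps → x₂ ∈ reps → x₁ ≢ x₂ → Reach W x₁ v → ¬ Reach W x₂ v
    components-disjoint {x₁} {x₂} x₁∈ x₂∈ x₁≢x₂ r₁ r₂ with FinP.<-cmp x₁ x₂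
    ... | tri< x₁<x₂ _ _ = proj₂ (rep⁻ x₂∈) x₁ x₁<x₂ (proj₁ (rep⁻ x₁∈)) (reach-trans r₁ (reach-sym r₂))
    ... | tri≈ _ x₁≡x₂ _ = x₁≢x₂ x₁≡x₂
    ... | tri> _ _ x₂<x₁ = proj₂ (rep⁻ x₁∈) x₂ x₂<x₁ (proj₁ (rep⁻ x₂∈)) (reach-trans r₂ (reach-sym r₁))

    -- The least root reaching y is a representative.
    components-cover : filter W? (allFin (n H)) ⊆ concatMap component reps
    components-cover {y} y∈ with rooted (proj₂ (∈-filter⁻ W? {xs = allFin (n H)} y∈))
    ... | x , rx , r with least (λ x₁ → R x₁ × Reach W x₁ y) (λ x₁ → R? x₁ ×-dec reachable? W? x₁ y) x (rx , r)
    ... | x₀ , (r₀ , ry₀) , below =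
      AnyP.concatMap⁺ component (lose x₀∈ (∈-filter⁺ (reachable? W? x₀) (∈-allFin y) ry₀))
      where
      x₀∈ : x₀ ∈ reps
      x₀∈ = ∈-filter⁺ IsRep? (∈-allFin x₀)
              (r₀ , λ x₁ x₁<x₀ r₁ r₁₀ → below x₁ x₁<x₀ (r₁ , reach-trans r₁₀ ry₀))

    region-size-via-components : ∀ {s} → (∀ {x} → R x → length (component x) ≤ s) →
      length (filter W? (allFin (n H))) ≤ length (blockTypes s (length A)) * twinBound k s * s
    region-size-via-components {s} small = begin
      length (filter W? (allFin (n H)))
        ≤⟨ unique⊆⇒length≤ (UniqueP.filter⁺ W? (UniqueP.allFin⁺ (n H))) components-cover ⟩
      length (concatMap component reps)
        ≤⟨ length-concatMap≤ component reps small-rep ⟩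
      length reps * s
        ≤⟨ *-monoˡ-≤ s few-reps ⟩
      length (blockTypes s (length A)) * twinBound k s * s
        ∎
      where
      open ≤-Reasoning
      small-rep : ∀ {x} → x ∈ reps → length (component x) ≤ s
      small-rep = small ∘ proj₁ ∘ rep⁻
      closed-component : ∀ {x u v} → x ∈ reps → Reach W x u → adj H u v ≡ true → Reach W x v ⊎ v ∈ A
      closed-component {u = u} {v} _ r e =
        Sum.map₁ (λ wv → reach-step r wv (trans (Graph.sym H v u) e)) (closed (reach-source r) e)
      few-reps : length reps ≤ length (blockTypes s (length A)) * twinBound k s
      few-reps = BlockPruning.few-blocks A (Reach W) (reachable? W?) reps
        (UniqueP.filter⁺ IsRep? (UniqueP.allFin⁺ (n H)))
        (reach-refl ∘ roots⊆ ∘ proj₁ ∘ rep⁻) closed-component components-disjoint s small-rep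

  region-size≤ : ∀ d A {W R} (W? : Decidable W) (R? : Decidable R) → Region d A W R →
                 length (filter W? (allFin (n H))) ≤ regionBound k d (length A)
  region-size≤ zero A W? R? reg =
    ≤-reflexive (cong length
      (ListP.filter-none W? {xs = allFin (n H)} (All.tabulate λ _ wy → root-too-deep (rooted wy))))
    where
    open Region reg
    root-too-deep : ∀ {y} → ∃ (λ x → _ × Reach _ x y) → ⊥
    root-too-deep (x , rx , _) = contradiction (shallow x [] ([] ∷ [] , tt) (roots⊆ rx ∷ []) rx) λ ()
  region-size≤ (suc d) A W? R? reg =
    region-size-via-components λ {x} rx →
      component-size≤ x (region-size≤ d (x ∷ A) (Below? x) (Child? x) (subregion rx))
    where open Rooted W? R? reg

  obstruction-size≤ : n H ≤ regionBound k L 0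
  obstruction-size≤ = subst (_≤ regionBound k L 0)
    (trans (cong length (ListP.filter-all (λ _ → yes tt) {xs = allFin (n H)} (All.tabulate λ _ → tt)))
           (length-allFin (n H)))
    (region-size≤ L [] (λ _ → yes tt) (λ _ → yes tt) record
      { closed  = λ _ _ → inj₁ tt
      ; roots⊆  = λ _ → tt
      ; shallow = λ y q path _ _ → obstruction-path≤2^k obs path
      ; rooted  = λ {y} _ → y , tt , reach-refl tt
      })

-- Enumerating small graphs

allFunctions : ∀ {B : Set} m → List B → List (Fin m → B)
allFunctions zero    univ = [ (λ ()) ]
allFunctions (suc m) univ = concatMap (λ b → map (b Vector.∷_) (allFunctions m univ)) univ

allFunctions-complete : ∀ {B : Set} (R : B → B → Set) {univ} → (∀ b → Any (R b) univ) →
                        ∀ m (h : Fin m → B) → Any (λ h′ → ∀ i → R (h i) (h′ i)) (allFunctions m univ)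
allFunctions-complete R         covers zero    h = here λ ()
allFunctions-complete R {univ} covers (suc m) h =
  AnyP.concatMap⁺ (λ b → map (b Vector.∷_) (allFunctions m univ))
    (Any.map (λ {b} r → AnyP.map⁺ (Any.map (pointwise-∷ r) (allFunctions-complete R covers m (h ∘ suc))))
      (covers (h zero)))
  where
  pointwise-∷ : ∀ {b h′} → R (h zero) b → (∀ i → R (h (suc i)) (h′ i)) → ∀ i → R (h i) ((b Vector.∷ h′) i)
  pointwise-∷ r _  zero    = r
  pointwise-∷ _ rs (suc i) = rs i

Matrix : ℕ → Set
Matrix m = Fin m → Fin m → Bool

allMatrices : ∀ m → List (Matrix m)
allMatrices m = allFunctions m (allFunctions m booleans)

allMatrices-complete : ∀ m (M : Matrix m) → Any (λ M′ → ∀ i j → M i j ≡ M′ i j) (allMatrices m)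
allMatrices-complete m = allFunctions-complete (λ r r′ → ∀ j → r j ≡ r′ j)
  (λ r → allFunctions-complete _≡_ (λ b → lose (∈-booleans b) refl) m r) m

symmetrise : ∀ {m} → Matrix m → Matrix m
symmetrise M i j with FinP.<-cmp i j
... | tri< _ _ _ = M i j
... | tri≈ _ _ _ = false
... | tri> _ _ _ = M j i

symmetrise-sym : ∀ {m} (M : Matrix m) i j → symmetrise M i j ≡ symmetrise M j i
symmetrise-sym M i j with FinP.<-cmp i j | FinP.<-cmp j i
... | tri< _ _ _   | tri> _ _ _   = refl
... | tri≈ _ _ _   | tri≈ _ _ _   = refl
... | tri> _ _ _   | tri< _ _ _   = refl
... | tri< i<j _ _ | tri< j<i _ _ = contradiction j<i (FinP.<-asym i<j)
... | tri< i<j _ _ | tri≈ _ j≡i _ = contradiction i<j (FinP.<-irrefl (sym j≡i))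
... | tri≈ _ i≡j _ | tri< j<i _ _ = contradiction j<i (FinP.<-irrefl (sym i≡j))
... | tri≈ _ i≡j _ | tri> _ _ i<j = contradiction i<j (FinP.<-irrefl i≡j)
... | tri> _ _ j<i | tri≈ _ j≡i _ = contradiction j<i (FinP.<-irrefl j≡i)
... | tri> _ _ j<i | tri> _ _ i<j = contradiction j<i (FinP.<-asym i<j)

symmetrise-irrefl : ∀ {m} (M : Matrix m) i → symmetrise M i i ≡ false
symmetrise-irrefl M i with FinP.<-cmp i i
... | tri< i<i _ _ = contradiction i<i (FinP.<-irrefl refl)
... | tri≈ _ _ _   = refl
... | tri> _ _ i<i = contradiction i<i (FinP.<-irrefl refl)

fromMatrix : ∀ m → Matrix m → Graph
fromMatrix m M = record { n = m ; adj = symmetrise M ; sym = symmetrise-sym M ; irrefl = symmetrise-irrefl M }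

symmetrise-adj : ∀ (H : Graph) (M : Matrix (n H)) → (∀ i j → adj H i j ≡ M i j) →
                 ∀ i j → adj H i j ≡ symmetrise M i j
symmetrise-adj H M adj≡M i j with FinP.<-cmp i j
... | tri< _ _    _ = adj≡M i j
... | tri≈ _ refl _ = irrefl H i
... | tri> _ _    _ = trans (Graph.sym H i j) (adj≡M j i)

graphsUpTo : ℕ → List Graph
graphsUpTo N = concatMap (λ m → map (fromMatrix m) (allMatrices m)) (upTo (suc N))

graphsUpTo-complete : ∀ N (H : Graph) → n H ≤ N → Any (H ≅_) (graphsUpTo N)
graphsUpTo-complete N H n≤N =
  AnyP.concatMap⁺ (λ m → map (fromMatrix m) (allMatrices m)) (lose (∈-upTo⁺ (s≤s n≤N)) copies)
  where
  copies : Any (H ≅_) (map (fromMatrix (n H)) (allMatrices (n H)))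
  copies = AnyP.map⁺
    (Any.map (λ {M} adj≡M → ↔-id _ , symmetrise-adj H M adj≡M) (allMatrices-complete (n H) (adj H)))

corollary5p3 : ∀ (k : ℕ) → Σ (List Graph) λ Hs →
    ∀ (H : Graph) → Obstruction k H → Any (λ H' → H ≅ H') Hs
corollary5p3 k = graphsUpTo (regionBound k (2 ^ k) 0) , λ H obs →
  graphsUpTo-complete _ H (ObstructionSize.obstruction-size≤ obs)
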